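{- Let $G$ be a connected graph of diameter $d$, let $B$ be a binary weighting on $G$, and let $C$ be a configuration on $G$ of size at least $(|B|-1)2^d + 1$ which is permissible with respect to $B$. Then $C$ is cover-solvable with respect to $B$.
   Context: A configuration on a graph $G$ is a function $C: V(G) \to \{0,1,2,\dots\}$ (the number of pebbles on each vertex); its size is $|C| = \sum_{v} C(v)$. A pebbling move removes two pebbles from some vertex and places one pebble on an adjacent vertex. A binary weighting on $G$ is a function $B: V(G) \to \{0,1\}$, with order $|B| = \sum_{v \in V(G)} B(v)$. A configuration $C$ is permissible with respect to $B$ if $B(v) = 0$ implies $C(v) = 0$ for all $v$. A permissible configuration $C$ is cover-solvable with respect to $B$ if, by a sequence of pebbling moves starting from $C$, one can reach a configuration $C'$ with $C'(v) \ge 1$ for every $v$ with $B(v) = 1$. -}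

module Defs where

open import Data.Nat using (ℕ; zero; suc; _+_; _*_; _∸_; _^_; _≤_)
open import Data.Fin using (Fin; zero; suc; _≟_)
open import Data.Bool using (Bool; true; false)
open import Data.Product using (Σ; ∃; ∃-syntax; _×_; _,_)
open import Relation.Binary.PropositionalEquality using (_≡_)
open import Relation.Nullary using (¬_; yes; no)
open import Relation.Binary.Construct.Closure.ReflexiveTransitive using (Star)

record Graph (n : ℕ) : Set₁ where
  field
    Adj    : Fin n → Fin n → Set
    sym    : ∀ {u v} → Adj u v → Adj v u
    irrefl : ∀ {u} → ¬ Adj u u
open Graph public

data Walk {n : ℕ} (G : Graph n) : Fin n → Fin n → ℕ → Set where
  [] : ∀ {u} → Walk G u u zero
  _∷_ : ∀ {u v w k} → Adj G u v → Walk G v w k → Walk G u w (suc k)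

DistLe : ∀ {n} → Graph n → Fin n → Fin n → ℕ → Set
DistLe G u v k = ∃[ l ] (l ≤ k × Walk G u v l)

HasDiameter : ∀ {n} → Graph n → ℕ → Set
HasDiameter {n} G d =
  (∀ u v → DistLe G u v d) ×
  (∃[ u ] ∃[ v ] (∀ l → Walk G u v l → d ≤ l))

Connected : ∀ {n} → Graph n → Set
Connected {n} G = ∀ u v → ∃[ l ] Walk G u v l

sumFin : ∀ n → (Fin n → ℕ) → ℕ
sumFin zero    f = zero
sumFin (suc n) f = f zero + sumFin n (λ i → f (suc i))

Configuration : ℕ → Set
Configuration n = Fin n → ℕ

size : ∀ {n} → Configuration n → ℕ
size {n} C = sumFin n C

BinaryWeighting : ℕ → Set
BinaryWeighting n = Fin n → Bool

bit : Bool → ℕ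
bit true  = 1
bit false = 0

order : ∀ {n} → BinaryWeighting n → ℕ
order {n} B = sumFin n (λ v → bit (B v))

applyMove : ∀ {n} → Configuration n → Fin n → Fin n → Configuration n
applyMove C u v w with w ≟ u | w ≟ v
... | yes _ | _     = C w ∸ 2
... | no _  | yes _ = C w + 1
... | no _  | no _  = C w

data Move {n} (G : Graph n) (C : Configuration n) : Configuration n → Set where
  move : ∀ u v → Adj G u v → 2 ≤ C u → Move G C (applyMove C u v)

Reachable : ∀ {n} → Graph n → Configuration n → Configuration n → Set
Reachable G = Star (Move G)

Permissible : ∀ {n} → BinaryWeighting n → Configuration n → Set
Permissible B C = ∀ v → B v ≡ false → C v ≡ 0

CoverSolvable : ∀ {n} → Graph n → BinaryWeighting n → Configuration n → Set
CoverSolvable G B C =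
  ∃[ C' ] (Reachable G C C' × (∀ v → B v ≡ true → 1 ≤ C' v))

{-# OPTIONS --safe #-}
-- Induct on |B|.  If some vertex v of B carries no pebble, then (|B| - 1) 2^d + 1 pebbles
-- cannot be spread over the remaining at most |B| - 1 vertices of B with fewer than 2^d on
-- each, so some vertex u holds 2^d pebbles.  Set these aside: the rest has size at least
-- (|B| - 2) 2^d + 1 and, by induction, covers B without v, while the 2^d set-aside pebbles
-- move one pebble along a path of length at most d from u to v.  Adding pebbles never
-- disables a move, so the two solutions run side by side.
module Submission where

open import Defs hiding (sym)
open import Data.Nat using (ℕ; zero; suc; _+_; _*_; _^_; _∸_; _≤_; _<_; _≤?_; z≤n)
open import Data.Nat.Properties renaming (_≟_ to _≟ℕ_)
open import Data.Bool.Properties using () renaming (_≟_ to _≟ᵇ_)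
open import Algebra.Properties.CommutativeSemigroup +-commutativeSemigroup
  using (interchange; xy∙z≈xz∙y)
open import Data.Nat.Induction using (<-wellFounded)
open import Data.Fin using (Fin; zero; suc; _≟_)
open import Data.Fin.Properties using (any?)
open import Data.Bool using (true; false)
open import Data.Product using (∃-syntax; _×_; _,_)
open import Data.Sum using (_⊎_; inj₁; inj₂)
open import Data.Vec.Functional using (updateAt)
open import Data.Vec.Functional.Properties using (updateAt-updates; updateAt-minimal)
open import Function using (const; _∘_)
open import Induction.WellFounded using (Acc; acc)
open import Relation.Nullary using (yes; no; contradiction)
open import Relation.Nullary.Decidable using (_×-dec_)
open import Relation.Binary.PropositionalEquality
open import Relation.Binary.Construct.Closure.ReflexiveTransitive using (ε; _◅_; _◅◅_)

sumFin-cong : ∀ n {f g : Fin n → ℕ} → f ≗ g → sumFin n f ≡ sumFin n g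
sumFin-cong zero    f≗g = refl
sumFin-cong (suc n) f≗g = cong₂ _+_ (f≗g zero) (sumFin-cong n (f≗g ∘ suc))

sumFin-mono : ∀ n {f g : Fin n → ℕ} → (∀ i → f i ≤ g i) → sumFin n f ≤ sumFin n g
sumFin-mono zero    f≤g = z≤n
sumFin-mono (suc n) f≤g = +-mono-≤ (f≤g zero) (sumFin-mono n (f≤g ∘ suc))

sumFin-zero : ∀ n → sumFin n (const 0) ≡ 0
sumFin-zero zero    = refl
sumFin-zero (suc n) = sumFin-zero n

sumFin-+ : ∀ n (f g : Fin n → ℕ) → sumFin n (λ i → f i + g i) ≡ sumFin n f + sumFin n g
sumFin-+ zero    f g = refl
sumFin-+ (suc n) f g = begin
  (f zero + g zero) + sumFin n (λ i → f (suc i) + g (suc i))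
    ≡⟨ cong (f zero + g zero +_) (sumFin-+ n (f ∘ suc) (g ∘ suc)) ⟩
  (f zero + g zero) + (sumFin n (f ∘ suc) + sumFin n (g ∘ suc))
    ≡⟨ interchange (f zero) (g zero) _ _ ⟩
  (f zero + sumFin n (f ∘ suc)) + (g zero + sumFin n (g ∘ suc)) ∎
  where open ≡-Reasoning

sumFin-*ʳ : ∀ n (f : Fin n → ℕ) k → sumFin n (λ i → f i * k) ≡ sumFin n f * k
sumFin-*ʳ zero    f k = refl
sumFin-*ʳ (suc n) f k = trans (cong (f zero * k +_) (sumFin-*ʳ n (f ∘ suc) k))
                              (sym (*-distribʳ-+ k (f zero) (sumFin n (f ∘ suc))))

private variable n : ℕ

_⊕_ : Configuration n → Configuration n → Configuration n
(C ⊕ D) w = C w + D w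

pebblesAt : Fin n → ℕ → Configuration n
pebblesAt u k = updateAt (const 0) u (const k)

withdraw : Configuration n → Fin n → ℕ → Configuration n
withdraw C u k = updateAt C u (_∸ k)

unmark : BinaryWeighting n → Fin n → BinaryWeighting n
unmark B v = updateAt B v (const false)

Covers : BinaryWeighting n → Configuration n → Set
Covers B C = ∀ v → B v ≡ true → 1 ≤ C v

size-pebblesAt : (u : Fin n) (k : ℕ) → size (pebblesAt u k) ≡ k
size-pebblesAt {suc n} zero    k = trans (cong (k +_) (sumFin-zero n)) (+-identityʳ k)
size-pebblesAt {suc n} (suc u) k = size-pebblesAt u k

module _ {n : ℕ} where

  ⊕-≤ˡ : ∀ {C D E : Configuration n} → E ≗ C ⊕ D → ∀ w → C w ≤ E w
  ⊕-≤ˡ {C} {D} E≗ w = ≤-trans (m≤m+n (C w) (D w)) (≤-reflexive (sym (E≗ w)))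

  ⊕-≤ʳ : ∀ {C D E : Configuration n} → E ≗ C ⊕ D → ∀ w → D w ≤ E w
  ⊕-≤ʳ {C} {D} E≗ w = ≤-trans (m≤n+m (D w) (C w)) (≤-reflexive (sym (E≗ w)))

  size-⊕ : ∀ {C D E : Configuration n} → E ≗ C ⊕ D → size E ≡ size C + size D
  size-⊕ {C} {D} E≗ = trans (sumFin-cong n E≗) (sumFin-+ n C D)

  withdraw-⊕-pebblesAt : ∀ {C : Configuration n} {u k} → k ≤ C u →
                         C ≗ withdraw C u k ⊕ pebblesAt u k
  withdraw-⊕-pebblesAt {C} {u} {k} k≤Cu w with w ≟ u
  ... | yes refl = begin
    C u                                 ≡⟨ m∸n+n≡m k≤Cu ⟨
    C u ∸ k + k                         ≡⟨ cong₂ _+_ (updateAt-updates u C)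
                                                     (updateAt-updates u (const 0)) ⟨
    withdraw C u k u + pebblesAt u k u  ∎
    where open ≡-Reasoning
  ... | no w≢u = begin
    C w                                 ≡⟨ +-identityʳ (C w) ⟨
    C w + 0                             ≡⟨ cong₂ _+_ (updateAt-minimal w u C w≢u)
                                                     (updateAt-minimal w u (const 0) w≢u) ⟨
    withdraw C u k w + pebblesAt u k w  ∎
    where open ≡-Reasoning

  withdraw-≤ : ∀ (C : Configuration n) u k w → withdraw C u k w ≤ C w
  withdraw-≤ C u k w with w ≟ u
  ... | yes refl = ≤-trans (≤-reflexive (updateAt-updates u C)) (m∸n≤m (C u) k)
  ... | no w≢u   = ≤-reflexive (updateAt-minimal w u C w≢u)

  size-withdraw : ∀ {C : Configuration n} {u k} → k ≤ C u →
                  size C ≡ size (withdraw C u k) + k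
  size-withdraw {C} {u} {k} k≤Cu = trans (size-⊕ (withdraw-⊕-pebblesAt k≤Cu))
                                         (cong (size (withdraw C u k) +_) (size-pebblesAt u k))

  bit-unmark-⊕-pebblesAt : ∀ {B : BinaryWeighting n} {v} → B v ≡ true →
                           bit ∘ B ≗ (bit ∘ unmark B v) ⊕ pebblesAt v 1
  bit-unmark-⊕-pebblesAt {B} {v} Bv w with w ≟ v
  ... | yes refl = begin
    bit (B v)                             ≡⟨ cong bit Bv ⟩
    1                                     ≡⟨ cong₂ _+_ (cong bit (updateAt-updates v B))
                                                       (updateAt-updates v (const 0)) ⟨
    bit (unmark B v v) + pebblesAt v 1 v  ∎
    where open ≡-Reasoning
  ... | no w≢v = begin
    bit (B w)                             ≡⟨ +-identityʳ (bit (B w)) ⟨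
    bit (B w) + 0                         ≡⟨ cong₂ _+_ (cong bit (updateAt-minimal w v B w≢v))
                                                       (updateAt-minimal w v (const 0) w≢v) ⟨
    bit (unmark B v w) + pebblesAt v 1 w  ∎
    where open ≡-Reasoning

  order-unmark : ∀ {B : BinaryWeighting n} {v} → B v ≡ true →
                 order B ≡ suc (order (unmark B v))
  order-unmark {B} {v} Bv =
    trans (size-⊕ (bit-unmark-⊕-pebblesAt Bv))
          (trans (cong (order (unmark B v) +_) (size-pebblesAt v 1)) (+-comm _ 1))

  uncovered-vertex : ∀ (B : BinaryWeighting n) (C : Configuration n) →
                     Covers B C ⊎ ∃[ v ] (B v ≡ true × C v ≡ 0)
  uncovered-vertex B C with any? (λ v → (B v ≟ᵇ true) ×-dec (C v ≟ℕ 0))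
  ... | yes found = inj₂ found
  ... | no none   = inj₁ λ v Bv → n≢0⇒n>0 (λ Cv → none (v , Bv , Cv))

  size-≤-order* : ∀ {B : BinaryWeighting n} {C : Configuration n} k →
                  (∀ w → C w ≤ bit (B w) * k) → size C ≤ order B * k
  size-≤-order* {B} k C≤ =
    ≤-trans (sumFin-mono n C≤) (≤-reflexive (sumFin-*ʳ n (bit ∘ B) k))

  heavy-vertex : ∀ {B : BinaryWeighting n} {C : Configuration n} {v} k →
                 Permissible B C → B v ≡ true → C v ≡ 0 →
                 order B * k + 1 ≤ size C + k → ∃[ u ] (k ≤ C u)
  heavy-vertex {B} {C} {v} k perm Bv Cv budget with any? (λ u → k ≤? C u)
  ... | yes found = found
  ... | no none   = contradiction (≤-trans budget too-few) (m+1+n≰m (order B * k) {0})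
    where
      light : ∀ w b → B w ≡ b → C w ≤ bit b * k
      light w true  _  = subst (C w ≤_) (sym (+-identityʳ k)) (<⇒≤ (≰⇒> (none ∘ (w ,_))))
      light w false Bw = ≤-reflexive (perm w Bw)

      bounded : ∀ w → C w ≤ bit (unmark B v w) * k
      bounded w with w ≟ v
      ... | yes refl = subst (_≤ _) (sym Cv) z≤n
      ... | no w≢v   = subst (λ b → C w ≤ bit b * k) (sym (updateAt-minimal w v B w≢v))
                             (light w (B w) refl)

      too-few : size C + k ≤ order B * k
      too-few = begin
        size C + k                      ≤⟨ +-monoˡ-≤ k (size-≤-order* k bounded) ⟩
        order (unmark B v) * k + k      ≡⟨ +-comm _ k ⟩
        suc (order (unmark B v)) * k    ≡⟨ cong (_* k) (order-unmark Bv) ⟨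
        order B * k                     ∎
        where open ≤-Reasoning

  permissible-unmark-withdraw : ∀ {B : BinaryWeighting n} {C : Configuration n} {u v} k →
                                Permissible B C → C v ≡ 0 →
                                Permissible (unmark B v) (withdraw C u k)
  permissible-unmark-withdraw {B} {C} {u} {v} k perm Cv w B′w =
    n≤0⇒n≡0 (≤-trans (withdraw-≤ C u k w) C≤0)
    where
      C≤0 : C w ≤ 0
      C≤0 with w ≟ v
      ... | yes refl = ≤-reflexive Cv
      ... | no w≢v   = ≤-reflexive (perm w (trans (sym (updateAt-minimal w v B w≢v)) B′w))

  budget-unmark-withdraw : ∀ {B : BinaryWeighting n} {C : Configuration n} {u v k} →
                           B v ≡ true → k ≤ C u → order B * k + 1 ≤ size C + k →
                           order (unmark B v) * k + 1 ≤ size (withdraw C u k) + k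
  budget-unmark-withdraw {B} {C} {u} {v} {k} Bv k≤Cu budget =
    +-cancelˡ-≤ k _ _ (subst₂ _≤_ (+-assoc k (order (unmark B v) * k) 1) (+-comm _ k)
      (subst₂ (λ b c → b * k + 1 ≤ c + k) (order-unmark Bv) (size-withdraw k≤Cu) budget))

module _ {n : ℕ} (G : Graph n) where

  applyMove-source : ∀ (C : Configuration n) u v → applyMove C u v u ≡ C u ∸ 2
  applyMove-source C u v with u ≟ u
  ... | yes _   = refl
  ... | no u≢u = contradiction refl u≢u

  applyMove-target : ∀ (C : Configuration n) {u v} → Adj G u v → applyMove C u v v ≡ C v + 1
  applyMove-target C {u} {v} uv with v ≟ u | v ≟ v
  ... | yes refl | _      = contradiction uv (irrefl G)
  ... | no _     | yes _  = refl
  ... | no _     | no v≢v = contradiction refl v≢v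

  applyMove-⊕ : ∀ {C C′ D : Configuration n} {u} v → C′ ≗ C ⊕ D → 2 ≤ C u →
                applyMove C′ u v ≗ applyMove C u v ⊕ D
  applyMove-⊕ {C} {C′} {D} {u} v C′≗ 2≤Cu w with w ≟ u | w ≟ v
  ... | yes refl | _     = trans (cong (_∸ 2) (C′≗ w)) (+-∸-comm (D w) 2≤Cu)
  ... | no _     | yes _ = trans (cong (_+ 1) (C′≗ w)) (xy∙z≈xz∙y (C w) (D w) 1)
  ... | no _     | no _  = C′≗ w

  reachable-⊕ : ∀ {C X C′ D : Configuration n} → Reachable G C X → C′ ≗ C ⊕ D →
                ∃[ X′ ] (Reachable G C′ X′ × X′ ≗ X ⊕ D)
  reachable-⊕ ε C′≗ = _ , ε , C′≗
  reachable-⊕ {D = D} (move u v uv 2≤Cu ◅ C→X) C′≗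
    with reachable-⊕ C→X (applyMove-⊕ v C′≗ 2≤Cu)
  ... | X′ , C′→X′ , X′≗ =
    X′ , move u v uv (≤-trans 2≤Cu (⊕-≤ˡ {D = D} C′≗ u)) ◅ C′→X′ , X′≗

  pebbles-across-edge : ∀ j {E : Configuration n} {u v} → Adj G u v → j * 2 ≤ E u →
                        ∃[ E′ ] (Reachable G E E′ × E v + j ≤ E′ v)
  pebbles-across-edge zero    {E} {v = v} uv _ = E , ε , ≤-reflexive (+-identityʳ (E v))
  -- suc j * 2 is definitionally 2 + j * 2, so subtracting the two moved pebbles leaves j * 2.
  pebbles-across-edge (suc j) {E} {u} {v} uv 2+2j≤Eu
    with pebbles-across-edge j {applyMove E u v} uv
           (subst (j * 2 ≤_) (sym (applyMove-source E u v)) (∸-monoˡ-≤ 2 2+2j≤Eu))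
  ... | E′ , E₁→E′ , le =
    E′ , move u v uv (≤-trans (m≤m+n 2 (j * 2)) 2+2j≤Eu) ◅ E₁→E′ , (begin
      E v + suc j            ≡⟨ +-assoc (E v) 1 j ⟨
      E v + 1 + j            ≡⟨ cong (_+ j) (applyMove-target E uv) ⟨
      applyMove E u v v + j  ≤⟨ le ⟩
      E′ v                   ∎)
    where open ≤-Reasoning

  pebbles-along-walk : ∀ {u v l} → Walk G u v l → ∀ m {E : Configuration n} →
                       m * 2 ^ l ≤ E u → ∃[ E′ ] (Reachable G E E′ × m ≤ E′ v)
  pebbles-along-walk [] m h = _ , ε , subst (_≤ _) (*-identityʳ m) h
  pebbles-along-walk {u} (_∷_ {v = x} {k = l} ux x↝v) m {E} h
    with pebbles-across-edge (m * 2 ^ l) ux (subst (_≤ E u) regroup h)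
    where regroup : m * (2 * 2 ^ l) ≡ m * 2 ^ l * 2
          regroup = trans (cong (m *_) (*-comm 2 (2 ^ l))) (sym (*-assoc m (2 ^ l) 2))
  ... | E₁ , E→E₁ , le₁ with pebbles-along-walk x↝v m (≤-trans (m≤n+m _ (E x)) le₁)
  ... | E₂ , E₁→E₂ , le₂ = E₂ , E→E₁ ◅◅ E₁→E₂ , le₂

  pebble-within-distance : ∀ {u v d} {E : Configuration n} → DistLe G u v d →
                           2 ^ d ≤ E u → ∃[ E′ ] (Reachable G E E′ × 1 ≤ E′ v)
  pebble-within-distance (l , l≤d , u↝v) h =
    pebbles-along-walk u↝v 1
      (subst (_≤ _) (sym (*-identityˡ (2 ^ l))) (≤-trans (^-monoʳ-≤ 2 l≤d) h))

  cover-solvable-unmark : ∀ {B : BinaryWeighting n} {v} {C C′ D : Configuration n} →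
                          CoverSolvable G (unmark B v) C′ → C ≗ C′ ⊕ D →
                          ∃[ E ] (Reachable G D E × 1 ≤ E v) → CoverSolvable G B C
  cover-solvable-unmark {B} {v} {D = D} (X , C′→X , X-covers) C≗ (E , D→E , 1≤Ev)
    with reachable-⊕ C′→X C≗
  ... | X₂ , C→X₂ , X₂≗
    with reachable-⊕ D→E (λ w → trans (X₂≗ w) (+-comm (X w) (D w)))
  ... | X₃ , X₂→X₃ , X₃≗ = X₃ , C→X₂ ◅◅ X₂→X₃ , X₃-covers
    where
      X₃-covers : Covers B X₃
      X₃-covers w Bw with w ≟ v
      ... | yes refl = ≤-trans 1≤Ev (⊕-≤ˡ {D = X} X₃≗ v)
      ... | no w≢v   = ≤-trans (X-covers w (trans (updateAt-minimal w v B w≢v) Bw))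
                               (⊕-≤ʳ {C = E} X₃≗ w)

  cover-solvable : ∀ {d} → (∀ u v → DistLe G u v d) →
                   ∀ {B : BinaryWeighting n} {C : Configuration n} → Acc _<_ (order B) →
                   Permissible B C → order B * 2 ^ d + 1 ≤ size C + 2 ^ d →
                   CoverSolvable G B C
  cover-solvable {d} diam {B} {C} (acc smaller) perm budget with uncovered-vertex B C
  ... | inj₁ covered = C , ε , covered
  ... | inj₂ (v , Bv , Cv) with heavy-vertex (2 ^ d) perm Bv Cv budget
  ... | u , 2^d≤Cu =
    cover-solvable-unmark
      (cover-solvable diam (smaller (≤-reflexive (sym (order-unmark {B = B} Bv))))
        (permissible-unmark-withdraw (2 ^ d) perm Cv)
        (budget-unmark-withdraw {B = B} {C = C} Bv 2^d≤Cu budget))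
      (withdraw-⊕-pebblesAt 2^d≤Cu)
      (pebble-within-distance (diam u v) (≤-reflexive (sym (updateAt-updates u (const 0)))))

mainTheorem3 : (n : ℕ) (G : Graph n) (d : ℕ) → Connected G → HasDiameter G d →
    (B : BinaryWeighting n) (C : Configuration n) →
    order B * 2 ^ d + 1 ≤ size C + 2 ^ d →
    Permissible B C → CoverSolvable G B C
mainTheorem3 n G d _ (diam , _) B C budget perm =
  cover-solvable G diam (<-wellFounded (order B)) perm budget
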